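{- For all unit types $U,V$ and types $T,R$: if $V\to R\preceq U\to T$, then there exist unit types $\vec{W}=W_1,\dots,W_n$ and type variables $\vec{X}=X_1,\dots,X_n$ such that $U\to T\equiv(V\to R)[\vec{W}/\vec{X}]$.
   Context: Scalars form a commutative ring $\mathcal{S}$. Types $T::=U\mid\forall X.T\mid\alpha.T\mid\overline{0}$; unit types $U::=X\mid U\to T\mid\forall X.U$. Type variables are substituted only by unit types, $(\alpha.T)[U/X]=\alpha.(T[U/X])$, and $T[\vec{W}/\vec{X}]$ means $T[W_1/X_1]\cdots[W_n/X_n]$. $\equiv$ is the least congruence with $\alpha.\overline{0}\equiv\overline{0}$, $0.T\equiv\overline{0}$, $1.T\equiv T$, $\alpha.(\beta.T)\equiv(\alpha\times\beta).T$, $\forall X.\alpha.T\equiv\alpha.\forall X.T$. Write $T\prec R$ if either $R\equiv\forall X.T$ for some $X$, or $T\equiv\forall X.S$ and $R\equiv S[U/X]$ for some type $S$, variable $X$ and unit type $U$; $\preceq$ is the reflexive-transitive closure of $\prec$. -}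

module Defs where

open import Level using (_⊔_)
open import Data.Nat using (ℕ; zero; suc; _<_; _≟_)
open import Data.Vec using (Vec; []; _∷_)
open import Data.Product using (∃; Σ; _×_; _,_)
open import Data.Sum using (_⊎_)
open import Relation.Nullary using (yes; no)
open import Algebra.Bundles using (CommutativeRing)
open import Relation.Binary.Construct.Closure.ReflexiveTransitive using (Star)

-- Types of the calculus, in locally-nameless representation:
-- free type variables are named by natural numbers (fv X), variables bound by
-- a ∀ are de Bruijn indices (bv i).  The named binder ∀X.T of the paper is
-- the derived operation  ∀[ X ] T = Π (close X T)  defined below; this makes
-- substitution capture-free and α-equivalence syntactic.
module Types {c ℓ} (𝓢 : CommutativeRing c ℓ) where
  open CommutativeRing 𝓢 renaming (Carrier to S)

  infixr 7 _⇒_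
  infixr 8 _·_

  data Ty : Set c where
    fv  : ℕ → Ty
    bv  : ℕ → Ty
    _⇒_ : Ty → Ty → Ty
    Π   : Ty → Ty         -- ∀ (body binds bv 0)
    _·_ : S → Ty → Ty
    𝟘   : Ty

  -- Grammar, under k enclosing binders:
  --   U ::= X | U → T | ∀X.U        T ::= U | ∀X.T | α.T | 0̄
  mutual
    data IsUnit (k : ℕ) : Ty → Set c where
      u-fv  : ∀ X → IsUnit k (fv X)
      u-bv  : ∀ {i} → i < k → IsUnit k (bv i)
      u-⇒   : ∀ {U T} → IsUnit k U → IsType k T → IsUnit k (U ⇒ T)
      u-Π   : ∀ {U} → IsUnit (suc k) U → IsUnit k (Π U)

    data IsType (k : ℕ) : Ty → Set c where
      t-unit : ∀ {U} → IsUnit k U → IsType k U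
      t-Π    : ∀ {T} → IsType (suc k) T → IsType k (Π T)
      t-·    : ∀ {T} α → IsType k T → IsType k (α · T)
      t-𝟘    : IsType k 𝟘

  UnitType : Ty → Set c
  UnitType = IsUnit 0

  Type : Ty → Set c
  Type = IsType 0

  closeAt : ℕ → ℕ → Ty → Ty
  closeAt X k (fv Y) with X ≟ Y
  ... | yes _ = bv k
  ... | no  _ = fv Y
  closeAt X k (bv i)    = bv i
  closeAt X k (U ⇒ T)   = closeAt X k U ⇒ closeAt X k T
  closeAt X k (Π T)     = Π (closeAt X (suc k) T)
  closeAt X k (α · T)   = α · closeAt X k T
  closeAt X k 𝟘         = 𝟘

  ∀[_]_ : ℕ → Ty → Ty
  ∀[ X ] T = Π (closeAt X 0 T)

  -- substitution T[W/X] of a (unit) type W for the free variable X.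
  -- W is closed w.r.t. bound variables, so no capture can occur.
  _[_/_] : Ty → Ty → ℕ → Ty
  fv Y    [ W / X ] with X ≟ Y
  ... | yes _ = W
  ... | no  _ = fv Y
  bv i    [ W / X ] = bv i
  (U ⇒ T) [ W / X ] = (U [ W / X ]) ⇒ (T [ W / X ])
  Π T     [ W / X ] = Π (T [ W / X ])
  (α · T) [ W / X ] = α · (T [ W / X ])
  𝟘       [ W / X ] = 𝟘

  _[_//_] : ∀ {n} → Ty → Vec Ty n → Vec ℕ n → Ty
  T [ []     // []     ] = T
  T [ W ∷ Ws // X ∷ Xs ] = (T [ W / X ]) [ Ws // Xs ]

  infix 4 _≡ᵀ_
  data _≡ᵀ_ : Ty → Ty → Set (c ⊔ ℓ) where
    ≡-refl  : ∀ {T} → T ≡ᵀ T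
    ≡-sym   : ∀ {T R} → T ≡ᵀ R → R ≡ᵀ T
    ≡-trans : ∀ {T R Q} → T ≡ᵀ R → R ≡ᵀ Q → T ≡ᵀ Q
    ≡-⇒     : ∀ {U U′ T T′} → U ≡ᵀ U′ → T ≡ᵀ T′ → (U ⇒ T) ≡ᵀ (U′ ⇒ T′)
    ≡-Π     : ∀ {T T′} → T ≡ᵀ T′ → Π T ≡ᵀ Π T′
    ≡-·     : ∀ {α β T T′} → α ≈ β → T ≡ᵀ T′ → (α · T) ≡ᵀ (β · T′)
    ax-·𝟘   : ∀ {α} → (α · 𝟘) ≡ᵀ 𝟘
    ax-0·   : ∀ {T} → (0# · T) ≡ᵀ 𝟘
    ax-1·   : ∀ {T} → (1# · T) ≡ᵀ T
    ax-··   : ∀ {α β T} → (α · (β · T)) ≡ᵀ ((α * β) · T)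
    ax-∀·   : ∀ {α T} → Π (α · T) ≡ᵀ (α · Π T)

  _≺_ : Ty → Ty → Set (c ⊔ ℓ)
  T ≺ R = (∃ λ X → R ≡ᵀ (∀[ X ] T))
        ⊎ (Σ Ty λ S → Σ ℕ λ X → Σ Ty λ U →
             Type S × UnitType U × (T ≡ᵀ (∀[ X ] S)) × (R ≡ᵀ (S [ U / X ])))

  _⪯_ : Ty → Ty → Set (c ⊔ ℓ)
  _⪯_ = Star _≺_

-- A type equivalent to V → R stays, along any ⪯-chain, equivalent to a type
-- ∀Y₁⋯∀Yₘ.((V → R)[W⃗/X⃗]) with unit types W⃗: generalisation adds a binder,
-- and instantiating the outermost binder of ∀Y.C by U gives C[U/Y], through
-- whose remaining binders the substitution is pushed after renaming them apart.
-- Instantiating when m = 0 would make an arrow equivalent to a ∀-type, and so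
-- would m > 0 at the end of a chain arriving at U → T.  This is impossible
-- unless 1 = 0 in 𝓢 (then every two types are equivalent), because the scalar
-- weight of arrows (1 for an arrow, 0 for a variable, ∀-type or 0̄, and α
-- times the weight of T for α.T) is invariant under ≡.
module Submission where

open import Defs
open import Data.Nat using (ℕ)
open import Data.Vec using (Vec)
open import Data.Vec.Relation.Unary.All using (All)
open import Data.Product using (Σ; _×_)
open import Algebra.Bundles using (CommutativeRing)

open import Level using (_⊔_)
open import Data.Nat using (suc; _≤_; _<_; z≤n; s≤s; _≟_) renaming (_⊔_ to _⊔ℕ_)
open import Data.Nat.Properties
  using (<-irrefl; <-≤-trans; m<n⇒m<1+n; n<1+n; m⊔n≤o⇒m≤o; m⊔n≤o⇒n≤o; m≤m⊔n; m≤n⊔m; ≤-trans)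
open import Data.List using (List; []; _∷_)
open import Data.Vec using ([]; _∷_; _++_)
open import Data.Vec.Relation.Unary.All using ([]; _∷_)
open import Data.Vec.Relation.Unary.All.Properties using (++⁺)
open import Data.Product using (_,_)
open import Data.Sum using (inj₁; inj₂)
open import Data.Empty using (⊥-elim)
open import Relation.Nullary using (yes; no)
open import Relation.Binary.PropositionalEquality
  using (_≡_; _≢_; refl; sym; trans; cong; cong₂; module ≡-Reasoning)
open import Relation.Binary.Construct.Closure.ReflexiveTransitive using (ε; _◅_)

module Development {c ℓ} (𝓢 : CommutativeRing c ℓ) where
  open Types 𝓢
  open CommutativeRing 𝓢
    renaming (Carrier to S; refl to ≈-refl; sym to ≈-sym; trans to ≈-trans)

  ≡⇒≡ᵀ : ∀ {A B} → A ≡ B → A ≡ᵀ B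
  ≡⇒≡ᵀ refl = ≡-refl

  arrowWeight : Ty → S
  arrowWeight (_ ⇒ _) = 1#
  arrowWeight (α · T) = α * arrowWeight T
  arrowWeight _       = 0#

  arrowWeight-cong : ∀ {A B} → A ≡ᵀ B → arrowWeight A ≈ arrowWeight B
  arrowWeight-cong ≡-refl          = ≈-refl
  arrowWeight-cong (≡-sym e)       = ≈-sym (arrowWeight-cong e)
  arrowWeight-cong (≡-trans e e′)  = ≈-trans (arrowWeight-cong e) (arrowWeight-cong e′)
  arrowWeight-cong (≡-⇒ _ _)       = ≈-refl
  arrowWeight-cong (≡-Π _)         = ≈-refl
  arrowWeight-cong (≡-· α≈β e)     = *-cong α≈β (arrowWeight-cong e)
  arrowWeight-cong (ax-·𝟘 {α})     = zeroʳ α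
  arrowWeight-cong ax-0·           = zeroˡ _
  arrowWeight-cong ax-1·           = *-identityˡ _
  arrowWeight-cong (ax-·· {α} {β} {T}) = ≈-sym (*-assoc α β (arrowWeight T))
  arrowWeight-cong (ax-∀· {α})     = ≈-sym (zeroʳ α)

  ⇒≡ᵀΠ⇒1≈0 : ∀ {A B C} → (A ⇒ B) ≡ᵀ Π C → 1# ≈ 0#
  ⇒≡ᵀΠ⇒1≈0 = arrowWeight-cong

  1≈0⇒≡ᵀ-total : 1# ≈ 0# → ∀ A B → A ≡ᵀ B
  1≈0⇒≡ᵀ-total 1≈0 A B = ≡-trans (≡ᵀ𝟘 A) (≡-sym (≡ᵀ𝟘 B))
    where
    ≡ᵀ𝟘 : ∀ A → A ≡ᵀ 𝟘
    ≡ᵀ𝟘 A = ≡-trans (≡-sym ax-1·) (≡-trans (≡-· 1≈0 ≡-refl) ax-0·)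

  -- Strips the outer ∀, also beneath scalars, so that it respects ≡ᵀ.
  unΠ : Ty → Ty
  unΠ (Π T)   = T
  unΠ (α · T) = α · unΠ T
  unΠ T       = T

  unΠ-cong : ∀ {A B} → A ≡ᵀ B → unΠ A ≡ᵀ unΠ B
  unΠ-cong ≡-refl         = ≡-refl
  unΠ-cong (≡-sym e)      = ≡-sym (unΠ-cong e)
  unΠ-cong (≡-trans e e′) = ≡-trans (unΠ-cong e) (unΠ-cong e′)
  unΠ-cong (≡-⇒ e e′)     = ≡-⇒ e e′
  unΠ-cong (≡-Π e)        = e
  unΠ-cong (≡-· α≈β e)    = ≡-· α≈β (unΠ-cong e)
  unΠ-cong ax-·𝟘          = ax-·𝟘
  unΠ-cong ax-0·          = ax-0·
  unΠ-cong ax-1·          = ax-1·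
  unΠ-cong ax-··          = ax-··
  unΠ-cong ax-∀·          = ≡-refl

  closeAt-cong : ∀ {A B} X k → A ≡ᵀ B → closeAt X k A ≡ᵀ closeAt X k B
  closeAt-cong X k ≡-refl         = ≡-refl
  closeAt-cong X k (≡-sym e)      = ≡-sym (closeAt-cong X k e)
  closeAt-cong X k (≡-trans e e′) = ≡-trans (closeAt-cong X k e) (closeAt-cong X k e′)
  closeAt-cong X k (≡-⇒ e e′)     = ≡-⇒ (closeAt-cong X k e) (closeAt-cong X k e′)
  closeAt-cong X k (≡-Π e)        = ≡-Π (closeAt-cong X (suc k) e)
  closeAt-cong X k (≡-· α≈β e)    = ≡-· α≈β (closeAt-cong X k e)
  closeAt-cong X k ax-·𝟘          = ax-·𝟘
  closeAt-cong X k ax-0·          = ax-0·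
  closeAt-cong X k ax-1·          = ax-1·
  closeAt-cong X k ax-··          = ax-··
  closeAt-cong X k ax-∀·          = ax-∀·

  openAt : ℕ → Ty → Ty → Ty
  openAt k U (fv Y) = fv Y
  openAt k U (bv i) with i ≟ k
  ... | yes _ = U
  ... | no  _ = bv i
  openAt k U (A ⇒ B) = openAt k U A ⇒ openAt k U B
  openAt k U (Π T)   = Π (openAt (suc k) U T)
  openAt k U (α · T) = α · openAt k U T
  openAt k U 𝟘       = 𝟘

  openAt-cong : ∀ {A B} k U → A ≡ᵀ B → openAt k U A ≡ᵀ openAt k U B
  openAt-cong k U ≡-refl         = ≡-refl
  openAt-cong k U (≡-sym e)      = ≡-sym (openAt-cong k U e)
  openAt-cong k U (≡-trans e e′) = ≡-trans (openAt-cong k U e) (openAt-cong k U e′)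
  openAt-cong k U (≡-⇒ e e′)     = ≡-⇒ (openAt-cong k U e) (openAt-cong k U e′)
  openAt-cong k U (≡-Π e)        = ≡-Π (openAt-cong (suc k) U e)
  openAt-cong k U (≡-· α≈β e)    = ≡-· α≈β (openAt-cong k U e)
  openAt-cong k U ax-·𝟘          = ax-·𝟘
  openAt-cong k U ax-0·          = ax-0·
  openAt-cong k U ax-1·          = ax-1·
  openAt-cong k U ax-··          = ax-··
  openAt-cong k U ax-∀·          = ax-∀·

  openAt-bv-self : ∀ k U → openAt k U (bv k) ≡ U
  openAt-bv-self k U with k ≟ k
  ... | yes _ = refl
  ... | no k≢k = ⊥-elim (k≢k refl)

  openAt-bv-< : ∀ {i k} U → i < k → openAt k U (bv i) ≡ bv i
  openAt-bv-< {i} {k} U i<k with i ≟ k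
  ... | yes refl = ⊥-elim (<-irrefl refl i<k)
  ... | no  _    = refl

  closeAt-fv-self : ∀ X k → closeAt X k (fv X) ≡ bv k
  closeAt-fv-self X k with X ≟ X
  ... | yes _ = refl
  ... | no X≢X = ⊥-elim (X≢X refl)

  closeAt-fv-other : ∀ {X Y} k → X ≢ Y → closeAt X k (fv Y) ≡ fv Y
  closeAt-fv-other {X} {Y} k X≢Y with X ≟ Y
  ... | yes X≡Y = ⊥-elim (X≢Y X≡Y)
  ... | no  _   = refl

  [/]-fv-self : ∀ X W → fv X [ W / X ] ≡ W
  [/]-fv-self X W with X ≟ X
  ... | yes _ = refl
  ... | no X≢X = ⊥-elim (X≢X refl)

  [/]-fv-other : ∀ {X Y} W → X ≢ Y → fv Y [ W / X ] ≡ fv Y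
  [/]-fv-other {X} {Y} W X≢Y with X ≟ Y
  ... | yes X≡Y = ⊥-elim (X≢Y X≡Y)
  ... | no  _   = refl

  data Scoped (k : ℕ) : Ty → Set c where
    fv  : ∀ X → Scoped k (fv X)
    bv  : ∀ {i} → i < k → Scoped k (bv i)
    _⇒_ : ∀ {A B} → Scoped k A → Scoped k B → Scoped k (A ⇒ B)
    Π   : ∀ {T} → Scoped (suc k) T → Scoped k (Π T)
    _·_ : ∀ {T} α → Scoped k T → Scoped k (α · T)
    𝟘   : Scoped k 𝟘

  mutual
    IsUnit⇒Scoped : ∀ {k A} → IsUnit k A → Scoped k A
    IsUnit⇒Scoped (u-fv X)  = fv X
    IsUnit⇒Scoped (u-bv i<k) = bv i<k
    IsUnit⇒Scoped (u-⇒ a b) = IsUnit⇒Scoped a ⇒ IsType⇒Scoped b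
    IsUnit⇒Scoped (u-Π a)   = Π (IsUnit⇒Scoped a)

    IsType⇒Scoped : ∀ {k A} → IsType k A → Scoped k A
    IsType⇒Scoped (t-unit a) = IsUnit⇒Scoped a
    IsType⇒Scoped (t-Π a)    = Π (IsType⇒Scoped a)
    IsType⇒Scoped (t-· α a)  = α · IsType⇒Scoped a
    IsType⇒Scoped t-𝟘        = 𝟘

  Scoped-weaken : ∀ {j k A} → j ≤ k → Scoped j A → Scoped k A
  Scoped-weaken j≤k (fv X)     = fv X
  Scoped-weaken j≤k (bv i<j)   = bv (<-≤-trans i<j j≤k)
  Scoped-weaken j≤k (a ⇒ b)    = Scoped-weaken j≤k a ⇒ Scoped-weaken j≤k b
  Scoped-weaken j≤k (Π a)      = Π (Scoped-weaken (s≤s j≤k) a)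
  Scoped-weaken j≤k (α · a)    = α · Scoped-weaken j≤k a
  Scoped-weaken j≤k 𝟘          = 𝟘

  Scoped-[/] : ∀ {k A W} X → Scoped 0 W → Scoped k A → Scoped k (A [ W / X ])
  Scoped-[/] X w (fv Y) with X ≟ Y
  ... | yes _ = Scoped-weaken z≤n w
  ... | no  _ = fv Y
  Scoped-[/] X w (bv i<k) = bv i<k
  Scoped-[/] X w (a ⇒ b)  = Scoped-[/] X w a ⇒ Scoped-[/] X w b
  Scoped-[/] X w (Π a)    = Π (Scoped-[/] X w a)
  Scoped-[/] X w (α · a)  = α · Scoped-[/] X w a
  Scoped-[/] X w 𝟘        = 𝟘

  Scoped-closeAt : ∀ {k A} X → Scoped k A → Scoped (suc k) (closeAt X k A)
  Scoped-closeAt {k} X (fv Y) with X ≟ Y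
  ... | yes _ = bv (n<1+n k)
  ... | no  _ = fv Y
  Scoped-closeAt X (bv i<k) = bv (m<n⇒m<1+n i<k)
  Scoped-closeAt X (a ⇒ b)  = Scoped-closeAt X a ⇒ Scoped-closeAt X b
  Scoped-closeAt X (Π a)    = Π (Scoped-closeAt X a)
  Scoped-closeAt X (α · a)  = α · Scoped-closeAt X a
  Scoped-closeAt X 𝟘        = 𝟘

  openAt-closeAt : ∀ {k T} X U → Scoped k T → openAt k U (closeAt X k T) ≡ T [ U / X ]
  openAt-closeAt {k} X U (fv Y) with X ≟ Y
  ... | yes _ = openAt-bv-self k U
  ... | no  _ = refl
  openAt-closeAt X U (bv i<k) = openAt-bv-< U i<k
  openAt-closeAt X U (a ⇒ b)  = cong₂ _⇒_ (openAt-closeAt X U a) (openAt-closeAt X U b)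
  openAt-closeAt X U (Π a)    = cong Π (openAt-closeAt X U a)
  openAt-closeAt X U (α · a)  = cong (α ·_) (openAt-closeAt X U a)
  openAt-closeAt X U 𝟘        = refl

  ∀[]-instance-cong : ∀ {X Y T T′} U → Scoped 0 T → Scoped 0 T′ →
                      ∀[ X ] T ≡ᵀ ∀[ Y ] T′ → T [ U / X ] ≡ᵀ T′ [ U / Y ]
  ∀[]-instance-cong {X} {Y} {T} {T′} U t t′ e =
    ≡-trans (≡⇒≡ᵀ (sym (openAt-closeAt X U t)))
      (≡-trans (openAt-cong 0 U (unΠ-cong e)) (≡⇒≡ᵀ (openAt-closeAt Y U t′)))

  fvBound : Ty → ℕ
  fvBound (fv X)  = suc X
  fvBound (bv _)  = 0
  fvBound (A ⇒ B) = fvBound A ⊔ℕ fvBound B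
  fvBound (Π T)   = fvBound T
  fvBound (α · T) = fvBound T
  fvBound 𝟘       = 0

  closeAt-fresh : ∀ {Y} k T → fvBound T ≤ Y → closeAt Y k T ≡ T
  closeAt-fresh {Y} k (fv Z) Z<Y with Y ≟ Z
  ... | yes refl = ⊥-elim (<-irrefl refl Z<Y)
  ... | no  _    = refl
  closeAt-fresh k (bv i)  _ = refl
  closeAt-fresh k (A ⇒ B) b =
    cong₂ _⇒_ (closeAt-fresh k A (m⊔n≤o⇒m≤o _ _ b)) (closeAt-fresh k B (m⊔n≤o⇒n≤o _ _ b))
  closeAt-fresh k (Π T)   b = cong Π (closeAt-fresh (suc k) T b)
  closeAt-fresh k (α · T) b = cong (α ·_) (closeAt-fresh k T b)
  closeAt-fresh k 𝟘       _ = refl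

  closeAt-rename : ∀ {Y Y′} k T → fvBound T ≤ Y′ →
                   closeAt Y k T ≡ closeAt Y′ k (T [ fv Y′ / Y ])
  closeAt-rename {Y} {Y′} k (fv Z) b with Y ≟ Z
  ... | yes _ = sym (closeAt-fv-self Y′ k)
  ... | no  _ = sym (closeAt-fresh k (fv Z) b)
  closeAt-rename k (bv i)  _ = refl
  closeAt-rename k (A ⇒ B) b =
    cong₂ _⇒_ (closeAt-rename k A (m⊔n≤o⇒m≤o _ _ b)) (closeAt-rename k B (m⊔n≤o⇒n≤o _ _ b))
  closeAt-rename k (Π T)   b = cong Π (closeAt-rename (suc k) T b)
  closeAt-rename k (α · T) b = cong (α ·_) (closeAt-rename k T b)
  closeAt-rename k 𝟘       _ = refl

  closeAt-[/] : ∀ {Y X W} k T → Y ≢ X → fvBound W ≤ Y →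
                closeAt Y k T [ W / X ] ≡ closeAt Y k (T [ W / X ])
  closeAt-[/] {Y} {X} {W} k (fv Z) Y≢X b with X ≟ Z
  ... | yes refl = begin
    closeAt Y k (fv X) [ W / X ] ≡⟨ cong (_[ W / X ]) (closeAt-fv-other k Y≢X) ⟩
    fv X [ W / X ]               ≡⟨ [/]-fv-self X W ⟩
    W                            ≡⟨ sym (closeAt-fresh k W b) ⟩
    closeAt Y k W                ∎
    where open ≡-Reasoning
  ... | no X≢Z with Y ≟ Z
  ...   | yes _ = refl
  ...   | no  _ = [/]-fv-other W X≢Z
  closeAt-[/] k (bv i)  _ _ = refl
  closeAt-[/] k (A ⇒ B) Y≢X b = cong₂ _⇒_ (closeAt-[/] k A Y≢X b) (closeAt-[/] k B Y≢X b)
  closeAt-[/] k (Π T)   Y≢X b = cong Π (closeAt-[/] (suc k) T Y≢X b)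
  closeAt-[/] k (α · T) Y≢X b = cong (α ·_) (closeAt-[/] k T Y≢X b)
  closeAt-[/] k 𝟘       _ _ = refl

  ∀[]-[/] : ∀ Y T W X → Σ ℕ λ Y′ → (∀[ Y ] T) [ W / X ] ≡ ∀[ Y′ ] (T [ fv Y′ / Y ] [ W / X ])
  ∀[]-[/] Y T W X = Y′ , cong Π (begin
      closeAt Y 0 T [ W / X ]                        ≡⟨ cong (_[ W / X ]) (closeAt-rename 0 T T-fresh) ⟩
      closeAt Y′ 0 (T [ fv Y′ / Y ]) [ W / X ]       ≡⟨ closeAt-[/] 0 (T [ fv Y′ / Y ]) Y′≢X W-fresh ⟩
      closeAt Y′ 0 (T [ fv Y′ / Y ] [ W / X ])       ∎)
    where
    open ≡-Reasoning
    Y′ = fvBound T ⊔ℕ fvBound W ⊔ℕ suc X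
    T-fresh : fvBound T ≤ Y′
    T-fresh = ≤-trans (m≤m⊔n (fvBound T) (fvBound W)) (m≤m⊔n _ (suc X))
    W-fresh : fvBound W ≤ Y′
    W-fresh = ≤-trans (m≤n⊔m (fvBound T) (fvBound W)) (m≤m⊔n _ (suc X))
    Y′≢X : Y′ ≢ X
    Y′≢X Y′≡X = <-irrefl (sym Y′≡X) (m≤n⊔m (fvBound T ⊔ℕ fvBound W) (suc X))

  [//]-++ : ∀ {m n} T (Ws : Vec Ty m) (Xs : Vec ℕ m) (Ws′ : Vec Ty n) (Xs′ : Vec ℕ n) →
            T [ Ws ++ Ws′ // Xs ++ Xs′ ] ≡ T [ Ws // Xs ] [ Ws′ // Xs′ ]
  [//]-++ T []       []       Ws′ Xs′ = refl
  [//]-++ T (W ∷ Ws) (X ∷ Xs) Ws′ Xs′ = [//]-++ (T [ W / X ]) Ws Xs Ws′ Xs′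

  [//]-⇒ : ∀ {n} A B (Ws : Vec Ty n) (Xs : Vec ℕ n) →
           (A ⇒ B) [ Ws // Xs ] ≡ (A [ Ws // Xs ] ⇒ B [ Ws // Xs ])
  [//]-⇒ A B []       []       = refl
  [//]-⇒ A B (W ∷ Ws) (X ∷ Xs) = [//]-⇒ (A [ W / X ]) (B [ W / X ]) Ws Xs

  record UnitSubst : Set c where
    constructor ⟨_,_,_⟩
    field
      {size} : ℕ
      types  : Vec Ty size
      vars   : Vec ℕ size
      units  : All UnitType types

  open UnitSubst

  infixl 9 _⟦_⟧
  _⟦_⟧ : Ty → UnitSubst → Ty
  T ⟦ σ ⟧ = T [ types σ // vars σ ]

  idˢ : UnitSubst
  idˢ = ⟨ [] , [] , [] ⟩

  _⨾_ : UnitSubst → UnitSubst → UnitSubst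
  σ ⨾ ρ = ⟨ types σ ++ types ρ , vars σ ++ vars ρ , ++⁺ (units σ) (units ρ) ⟩

  ⟦⟧-⨾ : ∀ T σ ρ → T ⟦ σ ⨾ ρ ⟧ ≡ T ⟦ σ ⟧ ⟦ ρ ⟧
  ⟦⟧-⨾ T σ ρ = [//]-++ T (types σ) (vars σ) (types ρ) (vars ρ)

  Scoped-⟦⟧ : ∀ {T} σ → Scoped 0 T → Scoped 0 (T ⟦ σ ⟧)
  Scoped-⟦⟧ ⟨ [] , [] , [] ⟩ t = t
  Scoped-⟦⟧ ⟨ W ∷ Ws , X ∷ Xs , w ∷ ws ⟩ t =
    Scoped-⟦⟧ ⟨ Ws , Xs , ws ⟩ (Scoped-[/] X (IsUnit⇒Scoped w) t)

  ∀[]-⟦⟧ : ∀ Y T σ → Σ ℕ λ Y′ → Σ UnitSubst λ ρ → (∀[ Y ] T) ⟦ σ ⟧ ≡ ∀[ Y′ ] (T ⟦ ρ ⟧)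
  ∀[]-⟦⟧ Y T ⟨ [] , [] , [] ⟩ = Y , idˢ , refl
  ∀[]-⟦⟧ Y T ⟨ W ∷ Ws , X ∷ Xs , w ∷ ws ⟩ =
    let Y′ , eq       = ∀[]-[/] Y T W X
        Y″ , ρ , eq′ = ∀[]-⟦⟧ Y′ (T [ fv Y′ / Y ] [ W / X ]) ⟨ Ws , Xs , ws ⟩
    in Y″ , ⟨ fv Y′ ∷ W ∷ types ρ , Y ∷ X ∷ vars ρ , u-fv Y′ ∷ w ∷ units ρ ⟩ ,
       trans (cong (_[ Ws // Xs ]) eq) eq′

  ∀⋆[_]_ : List ℕ → Ty → Ty
  ∀⋆[ [] ]     T = T
  ∀⋆[ Y ∷ Ys ] T = ∀[ Y ] ∀⋆[ Ys ] T

  Scoped-∀⋆ : ∀ {T} Ys → Scoped 0 T → Scoped 0 (∀⋆[ Ys ] T)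
  Scoped-∀⋆ []       t = t
  Scoped-∀⋆ (Y ∷ Ys) t = Π (Scoped-closeAt Y (Scoped-∀⋆ Ys t))

  ∀⋆-⟦⟧ : ∀ Ys T σ → Σ (List ℕ) λ Ys′ → Σ UnitSubst λ ρ → (∀⋆[ Ys ] T) ⟦ σ ⟧ ≡ ∀⋆[ Ys′ ] (T ⟦ ρ ⟧)
  ∀⋆-⟦⟧ []       T σ = [] , σ , refl
  ∀⋆-⟦⟧ (Y ∷ Ys) T σ =
    let Y′ , ρ , eq     = ∀[]-⟦⟧ Y (∀⋆[ Ys ] T) σ
        Ys′ , ρ′ , eq′ = ∀⋆-⟦⟧ Ys T ρ
    in Y′ ∷ Ys′ , ρ′ , trans eq (cong (∀[ Y′ ]_) eq′)

  module _ {V R : Ty} (VR-scoped : Scoped 0 (V ⇒ R)) where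

    GeneralisedInstance : Ty → Set (c ⊔ ℓ)
    GeneralisedInstance A =
      Σ (List ℕ) λ Ys → Σ UnitSubst λ σ → A ≡ᵀ ∀⋆[ Ys ] ((V ⇒ R) ⟦ σ ⟧)

    Π≡ᵀinstance⇒1≈0 : ∀ {T} σ → Π T ≡ᵀ (V ⇒ R) ⟦ σ ⟧ → 1# ≈ 0#
    Π≡ᵀinstance⇒1≈0 σ e =
      ⇒≡ᵀΠ⇒1≈0 (≡-trans (≡⇒≡ᵀ (sym ([//]-⇒ V R (types σ) (vars σ)))) (≡-sym e))

    ≺-GeneralisedInstance : ∀ {A B} → GeneralisedInstance A → A ≺ B → GeneralisedInstance B
    ≺-GeneralisedInstance (Ys , σ , A≡) (inj₁ (X , B≡)) =
      X ∷ Ys , σ , ≡-trans B≡ (≡-Π (closeAt-cong X 0 A≡))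
    ≺-GeneralisedInstance {B = B} ([] , σ , A≡) (inj₂ (_ , _ , _ , _ , _ , A≡∀ , _)) =
      [] , idˢ , 1≈0⇒≡ᵀ-total (Π≡ᵀinstance⇒1≈0 σ (≡-trans (≡-sym A≡∀) A≡)) B (V ⇒ R)
    ≺-GeneralisedInstance (Y ∷ Ys , σ , A≡) (inj₂ (T , X , U , t , u , A≡∀ , B≡))
      with Ys′ , ρ , eq ← ∀⋆-⟦⟧ Ys ((V ⇒ R) ⟦ σ ⟧) ⟨ U ∷ [] , Y ∷ [] , u ∷ [] ⟩ =
        Ys′ , σ ⨾ ρ ,
        ≡-trans B≡ (≡-trans instance≡
          (≡⇒≡ᵀ (trans eq (cong ∀⋆[ Ys′ ]_ (sym (⟦⟧-⨾ (V ⇒ R) σ ρ))))))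
      where
      instance≡ : T [ U / X ] ≡ᵀ (∀⋆[ Ys ] ((V ⇒ R) ⟦ σ ⟧)) [ U / Y ]
      instance≡ = ∀[]-instance-cong U (IsType⇒Scoped t)
        (Scoped-∀⋆ Ys (Scoped-⟦⟧ σ VR-scoped)) (≡-trans (≡-sym A≡∀) A≡)

    ⪯-GeneralisedInstance : ∀ {A B} → GeneralisedInstance A → A ⪯ B → GeneralisedInstance B
    ⪯-GeneralisedInstance g ε        = g
    ⪯-GeneralisedInstance g (r ◅ rs) = ⪯-GeneralisedInstance (≺-GeneralisedInstance g r) rs

    GeneralisedInstance-⇒ : ∀ {U T} → GeneralisedInstance (U ⇒ T) →
                            Σ UnitSubst λ σ → (U ⇒ T) ≡ᵀ (V ⇒ R) ⟦ σ ⟧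
    GeneralisedInstance-⇒ ([] , σ , UT≡) = σ , UT≡
    GeneralisedInstance-⇒ {U} {T} (_ ∷ _ , _ , UT≡) =
      idˢ , 1≈0⇒≡ᵀ-total (⇒≡ᵀΠ⇒1≈0 UT≡) (U ⇒ T) (V ⇒ R)

mainTheorem9 : ∀ {c ℓ} (𝓢 : CommutativeRing c ℓ) → let open Types 𝓢 in
    ∀ (U V T R : Ty) → UnitType U → UnitType V → Type T → Type R →
    (V ⇒ R) ⪯ (U ⇒ T) →
    Σ ℕ λ n → Σ (Vec Ty n) λ Ws → Σ (Vec ℕ n) λ Xs →
    All UnitType Ws × ((U ⇒ T) ≡ᵀ ((V ⇒ R) [ Ws // Xs ]))
mainTheorem9 𝓢 U V T R _ uV _ tR VR⪯UT =
  let ⟨ Ws , Xs , ws ⟩ , UT≡ = GeneralisedInstance-⇒ VR-scoped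
                                 (⪯-GeneralisedInstance VR-scoped ([] , idˢ , ≡-refl) VR⪯UT)
  in _ , Ws , Xs , ws , UT≡
  where
  open Types 𝓢
  open Development 𝓢
  VR-scoped : Scoped 0 (V ⇒ R)
  VR-scoped = IsUnit⇒Scoped (u-⇒ uV tR)
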